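{- For every agent $i$ and every formula $\phi$ of $\mathbf{LUT}$, $\vDash U_i\phi\to U_iU_i\phi$, and consequently $\vDash U_i\phi\leftrightarrow U_iU_i\phi$.
   Context: Let $\mathbf{P}$ be a countably infinite set of propositional variables and $\mathbf{I}$ a finite set of agents. The language $\mathbf{LUT}$ is given by $\phi::= p\mid\neg\phi\mid(\phi\land\phi)\mid K_i\phi\mid[\phi]\phi\mid U_i\phi$ ($p\in\mathbf{P}$, $i\in\mathbf{I}$); $\mathbf{EL}$ is the fragment without $[\cdot]$ and $U_i$. A model is $\mathcal{M}=\langle S,\{R_i\}_{i\in\mathbf{I}},V\rangle$ with $S\neq\emptyset$, each $R_i$ a reflexive relation on $S$, $V:\mathbf{P}\to2^S$. Truth: $p$ true at $s$ iff $s\in V(p)$; Boolean clauses as usual; $\mathcal{M},s\vDash K_i\phi$ iff $\phi$ holds at all $t$ with $sR_it$; $\mathcal{M},s\vDash[\psi]\phi$ iff ($\mathcal{M},s\vDash\psi$ implies $\mathcal{M}|_\psi,s\vDash\phi$), with $\mathcal{M}|_\psi$ the restriction of $\mathcal{M}$ to the states where $\psi$ is true; $\mathcal{M},s\vDash U_i\phi$ iff $\mathcal{M},s\vDash\phi$ and for all $\psi\in\mathbf{EL}$, $\mathcal{M},s\vDash[\psi]\neg K_i\phi$. $\vDash\phi$ means $\phi$ is true at every state of every model. -}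

module Defs where

open import Data.Nat using (ℕ)
open import Data.Fin using (Fin)
open import Data.Product using (Σ; _×_; _,_; proj₁)
open import Data.Empty using (⊥)
open import Relation.Nullary using (¬_)
open import Relation.Binary using (Reflexive)

Prop : Set
Prop = ℕ

module _ (n : ℕ) where

  Agent : Set
  Agent = Fin n

  data EL : Set where
    atomE : Prop → EL
    negE  : EL → EL
    andE  : EL → EL → EL
    KE    : Agent → EL → EL

  data LUT : Set where
    atom : Prop → LUT
    neg  : LUT → LUT
    and  : LUT → LUT → LUT
    K    : Agent → LUT → LUT
    ann  : LUT → LUT → LUT   -- ann ψ φ  =  [ψ]φ
    U    : Agent → LUT → LUT

  embed : EL → LUT
  embed (atomE p) = atom p
  embed (negE φ) = neg (embed φ)
  embed (andE φ ψ) = and (embed φ) (embed ψ)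
  embed (KE i φ) = K i (embed φ)

  _⇒_ : LUT → LUT → LUT
  φ ⇒ ψ = neg (and φ (neg ψ))

  _⇔_ : LUT → LUT → LUT
  φ ⇔ ψ = and (φ ⇒ ψ) (ψ ⇒ φ)

  record Model : Set₁ where
    field
      S     : Set
      s₀    : S                       -- S ≠ ∅
      R     : Agent → S → S → Set
      Rrefl : ∀ i → Reflexive (R i)
      V     : Prop → S → Set
  open Model public

  -- Restriction of a model to the states satisfying a predicate P,
  -- given a state where P holds (witnessing non-emptiness).
  restrict : (M : Model) → (P : S M → Set) → (s : S M) → P s → Model
  restrict M P s ps = record
    { S     = Σ (S M) P
    ; s₀    = s , ps
    ; R     = λ i x y → R M i (proj₁ x) (proj₁ y)
    ; Rrefl = λ i → Rrefl M i
    ; V     = λ p x → V M p (proj₁ x)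
    }

  _,_⊨ᴱ_ : (M : Model) → S M → EL → Set
  M , s ⊨ᴱ atomE p = V M p s
  M , s ⊨ᴱ negE φ = ¬ (M , s ⊨ᴱ φ)
  M , s ⊨ᴱ andE φ ψ = (M , s ⊨ᴱ φ) × (M , s ⊨ᴱ ψ)
  M , s ⊨ᴱ KE i φ = ∀ t → R M i s t → M , t ⊨ᴱ φ

  _,_⊨_ : (M : Model) → S M → LUT → Set
  M , s ⊨ atom p = V M p s
  M , s ⊨ neg φ = ¬ (M , s ⊨ φ)
  M , s ⊨ and φ ψ = (M , s ⊨ φ) × (M , s ⊨ ψ)
  M , s ⊨ K i φ = ∀ t → R M i s t → M , t ⊨ φ
  M , s ⊨ ann ψ φ =
    (h : M , s ⊨ ψ) → restrict M (λ x → M , x ⊨ ψ) s h , (s , h) ⊨ φ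
  -- M,s ⊨ U_i φ iff M,s ⊨ φ and for all ψ ∈ EL, M,s ⊨ [ψ]¬K_i φ
  -- (the clause [ψ]¬K_i φ is unfolded: if M,s ⊨ ψ then in M|ψ, at s,
  --  it is not the case that φ holds at all R_i-successors)
  M , s ⊨ U i φ =
    (M , s ⊨ φ) ×
    (∀ (ψ : EL) (h : M , s ⊨ᴱ ψ) →
      ¬ (∀ t → R (restrict M (λ x → M , x ⊨ᴱ ψ) s h) i (s , h) t →
               restrict M (λ x → M , x ⊨ᴱ ψ) s h , t ⊨ φ))

  Valid : LUT → Set₁
  Valid φ = ∀ (M : Model) (s : S M) → M , s ⊨ φ

{-# OPTIONS --safe #-}
-- U_i φ implies φ, and the second conjunct of U_i is antitone in its argument
-- (strengthening θ only makes ¬K_i θ easier); applied with θ = U_i φ this turns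
-- U_i φ into U_i U_i φ. The converse is the first conjunct of U_i U_i φ.
module Submission where

open import Defs
open import Data.Nat using (ℕ)
open import Data.Product using (_×_; _,_; proj₁)

module _ {n : ℕ} where

  ⊨⇒-intro : ∀ {M s} (φ ψ : LUT n) →
    (_,_⊨_ n M s φ → _,_⊨_ n M s ψ) → _,_⊨_ n M s (_⇒_ n φ ψ)
  ⊨⇒-intro _ _ f (sφ , ¬sψ) = ¬sψ (f sφ)

  ⊨U⇒⊨ : ∀ {M s} i (φ : LUT n) → _,_⊨_ n M s (U i φ) → _,_⊨_ n M s φ
  ⊨U⇒⊨ _ _ = proj₁

  ⊨U-antitone : ∀ {M s} i (θ φ : LUT n) →
    (∀ (N : Model n) t → _,_⊨_ n N t θ → _,_⊨_ n N t φ) →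
    _,_⊨_ n M s θ → _,_⊨_ n M s (U i φ) → _,_⊨_ n M s (U i θ)
  ⊨U-antitone _ _ _ θ⇒φ sθ (_ , ¬Kφ) =
    sθ , λ ψ sψ Kθ → ¬Kφ ψ sψ (λ t r → θ⇒φ _ t (Kθ t r))

  ⊨U⇒⊨UU : ∀ {M s} i (φ : LUT n) →
    _,_⊨_ n M s (U i φ) → _,_⊨_ n M s (U i (U i φ))
  ⊨U⇒⊨UU i φ sUφ = ⊨U-antitone i (U i φ) φ (λ _ _ → ⊨U⇒⊨ i φ) sUφ sUφ

mainTheorem5 : (n : ℕ) (i : Agent n) (φ : LUT n) →
    Valid n (_⇒_ n (U i φ) (U i (U i φ))) × Valid n (_⇔_ n (U i φ) (U i (U i φ)))
mainTheorem5 n i φ = forward , λ M s → forward M s , backward M s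
  where
  forward : Valid n (_⇒_ n (U i φ) (U i (U i φ)))
  forward _ _ = ⊨⇒-intro (U i φ) (U i (U i φ)) (⊨U⇒⊨UU i φ)

  backward : Valid n (_⇒_ n (U i (U i φ)) (U i φ))
  backward _ _ = ⊨⇒-intro (U i (U i φ)) (U i φ) (⊨U⇒⊨ i (U i φ))
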